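{- Let $n\in\mathbb{N}$, $\sigma=\sigma_1\cdots\sigma_n\in\mathfrak{S}_n$ and $\mathbf{y}=(y_1,\ldots,y_n)\in\mathbb{N}^n$. Fix $i\in[n]$. Then: (1) if $i=1$ or $\sigma_{i-1}>\sigma_i$, then $|\mathrm{Pref}_{\mathsf{PA}_n}(\sigma_i)|=1$; (2) if $i\ge 2$ and $\sigma_j<\sigma_i$ for all $j\in[i-1]$ (i.e. $T(\sigma_i)=\beta_1$), then $|\mathrm{Pref}_{\mathsf{PA}_n}(\sigma_i)|=1+\sum_{k=1}^{i-1}y_{\sigma_k}$; (3) otherwise (so $\sigma_{i-1}<\sigma_i$ and some $\sigma_j>\sigma_i$ with $j<i$), writing $T(\sigma_i)=\sigma_1\cdots\sigma_{i-1}$ as $\alpha_\ell\beta_\ell\cdots\alpha_1\beta_1$ (if $\sigma_1>\sigma_i$) or $\beta_{\ell+1}\alpha_\ell\beta_\ell\cdots\alpha_1\beta_1$ (if $\sigma_1<\sigma_i$) as described below, and setting \[m(i)=\min\Big\{1\le j\le\ell:\ \sum_{\sigma_k\in\alpha_j}y_{\sigma_k}\ge y_{\sigma_i}\Big\},\] we have $|\mathrm{Pref}_{\mathsf{PA}_n}(\sigma_i)|=1+\sum_{k=1}^{i-1}y_{\sigma_k}$ if $m(i)$ does not exist (the set is empty), and \[|\mathrm{Pref}_{\mathsf{PA}_n}(\sigma_i)|=\sum_{\sigma_k\in\beta_{m(i)}\alpha_{m(i)-1}\beta_{m(i)-1}\cdots\alpha_1\beta_1\sigma_i}y_{\sigma_k}\]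 if $m(i)$ exists, i.e. the sum of the lengths of car $\sigma_i$ and of all cars in the blocks $\beta_1,\ldots,\beta_{m(i)}$ and $\alpha_1,\ldots,\alpha_{m(i)-1}$.
   Context: Parking assortments: $n$ cars $1,\ldots,n$ with lengths $y_1,\ldots,y_n$ park on $m=\sum_i y_i$ spots $1,\ldots,m$ of a one-way street, entering in order $1,\ldots,n$. Car $i$ with preference $x_i\in[m]$ parks in spots $x_i,\ldots,x_i+y_i-1$ if unoccupied; otherwise it proceeds down the street and parks in the first (leftmost) block of $y_i$ contiguous unoccupied spots after $x_i$; if none exists parking fails. The permutation $\sigma$ describes a parking order: $\sigma_j=i$ means car $i$ is the $j$th car from the left on the street, so car $\sigma_j$ occupies spots $1+\sum_{k<j}y_{\sigma_k},\ldots,\sum_{k\le j}y_{\sigma_k}$. $\mathrm{Pref}_{\mathsf{PA}_n}(\sigma_i)$ is the set of possible preferences for car $\sigma_i$ such that, under the parking assortment rule, it is the $i$th car to park on the street (it parks in its position prescribed by $\sigma$, given the cars arriving before it are in their positions prescribed by $\sigma$). Block decomposition: when $\sigma_{i-1}<\sigma_i$, the word $T(\sigma_i)=\sigma_1\sigma_2\cdots\sigma_{i-1}$ is split, reading from the right, into maximal contiguous blocks alternately consisting of entries less than $\sigma_i$ and entries greater than $\sigma_i$: $\beta_1$ is the maximal block of entries $<\sigma_i$ ending at position $i-1$, $\alpha_1$ the maximal block of entries $>\sigma_i$ immediately to its left, $\beta_2$ the maximal block of entries $<\sigma_i$ to the left of that, and so on, until position 1 is reached; $\ell$ is the number of $\alpha$-blocks.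 Blocks are identified with the sets of car labels they contain. -}

module Defs where

open import Data.Nat using (ℕ; zero; suc; _+_; _∸_; _<ᵇ_; _≤ᵇ_)
open import Data.Bool using (Bool; true; false; not; _∧_; if_then_else_)
import Data.Bool as Bool
open import Data.Fin using (Fin; toℕ)
open import Data.Fin.Permutation using (Permutation′; _⟨$⟩ʳ_)
open import Data.List using (List; []; _∷_; [_]; map; length; upTo; allFin; filterᵇ; reverse; head)
open import Data.Nat.ListAction using (sum)
open import Data.Bool.ListAction using (any; all)
open import Data.Maybe using (Maybe; just; nothing)
open import Data.Product using (_×_; _,_; proj₁; proj₂)
open import Relation.Nullary using (does)

runs : {A : Set} → (A → Bool) → List A → List (Bool × List A)
runs p [] = []
runs p (x ∷ xs) with runs p xs
... | [] = (p x , [ x ]) ∷ []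
... | (b , g) ∷ gs =
  if does (p x Bool.≟ b) then (b , x ∷ g) ∷ gs else (p x , [ x ]) ∷ (b , g) ∷ gs

-- Parking data: σ : permutation of the cars (σ ⟨$⟩ʳ j = car in the j-th place from the
-- left, 0-based j), y : lengths of the cars (indexed by car label, 0-based labels).
-- Car labels / positions are 0-based (Fin n); street spots are 1-based (1..m).
module _ {n : ℕ} (σ : Permutation′ n) (y : Fin n → ℕ) where

  car : Fin n → Fin n
  car j = σ ⟨$⟩ʳ j

  len : Fin n → ℕ
  len j = y (car j)

  positionsBefore : Fin n → List (Fin n)
  positionsBefore i = filterᵇ (λ k → toℕ k <ᵇ toℕ i) (allFin n)

  -- Σ_{k<i} y_{σ_k}; car σ_i occupies spots before i + 1 , … , before i + len i
  before : Fin n → ℕ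
  before i = sum (map len (positionsBefore i))

  totalLength : ℕ
  totalLength = sum (map y (allFin n))

  -- spot s is occupied when car σ_i enters: cars arriving before car σ_i are exactly
  -- those with smaller label, and they sit in their positions prescribed by σ.
  occupied : Fin n → ℕ → Bool
  occupied i s = any (λ k → (toℕ (car k) <ᵇ toℕ (car i)) ∧ ((before k <ᵇ s) ∧ (s ≤ᵇ before k + len k))) (allFin n)

  freeBlock : Fin n → ℕ → Bool
  freeBlock i q = (1 ≤ᵇ q) ∧ ((q + len i ≤ᵇ suc totalLength) ∧ all (λ t → not (occupied i (q + t))) (upTo (len i)))

  parkAt : Fin n → ℕ → Maybe ℕ
  parkAt i x = head (filterᵇ (λ q → (x ≤ᵇ q) ∧ freeBlock i q) (upTo (suc totalLength)))

  isPref : Fin n → ℕ → Bool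
  isPref i x with parkAt i x
  ... | just q = does (q Data.Nat.≟ suc (before i))
  ... | nothing = false

  -- Pref_{PA_n}(σ_i) ⊆ [m], as a duplicate-free list
  Pref : Fin n → List ℕ
  Pref i = filterᵇ (λ x → (1 ≤ᵇ x) ∧ isPref i x) (upTo (suc totalLength))

  -- the blocks of T(σ_i) read from the right: tagged true = entries < σ_i (β-blocks),
  -- false = entries > σ_i (α-blocks); in right-to-left order β₁, α₁, β₂, α₂, …
  blocks : Fin n → List (Bool × List (Fin n))
  blocks i = runs (λ k → toℕ (car k) <ᵇ toℕ (car i)) (reverse (positionsBefore i))

  blockLength : List (Fin n) → ℕ
  blockLength b = sum (map len b)

  alphaLengths : Fin n → List ℕ
  alphaLengths i = map (λ b → blockLength (proj₂ b)) (filterᵇ (λ b → not (proj₁ b)) (blocks i))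

  betaLengths : Fin n → List ℕ
  betaLengths i = map (λ b → blockLength (proj₂ b)) (filterᵇ proj₁ (blocks i))

-- When car σᵢ arrives, the spots 1 … B to the left of its place B + 1 … B + Y are covered by
-- σ₁ … σᵢ₋₁, and exactly those σⱼ < σᵢ are already parked: read leftwards from the car, the
-- street is β₁ α₁ β₂ … with the β-blocks occupied and the α-blocks free, and B + 1 … B + Y are
-- free. Under first fit the car parks at B + 1 exactly when its preference lies in (r, B + 1],
-- where r is the last spot ≤ B at which Y free spots begin (r = 0 if there is none). If β₁ is
-- empty then r = B; otherwise r starts the last Y spots of the first α-block of length ≥ Y, if
-- any, and B + 1 − r is the stated sum of lengths.
module Submission where

open import Defs
open import Data.Bool using (Bool; true; false; not; _∧_; if_then_else_; T)
import Data.Bool as Bool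
open import Data.Bool.ListAction using (any; all)
open import Data.Bool.Properties using (T-≡; T-∧; ∧-zeroʳ; ¬-not)
open import Data.Empty using (⊥-elim)
open import Data.Fin using (Fin; zero; suc; toℕ; inject₁)
open import Data.Fin.Permutation using (Permutation′)
open import Data.Fin.Properties using (toℕ-inject₁; toℕ-injective)
open import Data.List
  using (List; []; _∷_; [_]; _++_; _∷ʳ_; map; length; lookup; take; upTo; applyUpTo; allFin; tabulate; filterᵇ; reverse; head)
open import Data.List.Membership.Propositional using (_∈_)
open import Data.List.Membership.Propositional.Properties using (∈-allFin; ∈-upTo⁺; ∈-filter⁻)
open import Data.List.Properties using (filter-none; filter-all; filter-≐; map-tabulate; map-++; map-∘; reverse-++; upTo-∷ʳ)
open import Data.List.Relation.Unary.All as All using (All; []; _∷_)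
open import Data.List.Relation.Unary.All.Properties using (all⁺; all⁻; applyUpTo⁺₁; map⁺)
import Data.List.Relation.Unary.Any as Any
open import Data.List.Relation.Unary.Any.Properties using (any⁺; any⁻; reverse⁻)
open import Data.Maybe using (just; nothing)
open import Data.Nat using (ℕ; zero; suc; _+_; _∸_; _<ᵇ_; _≤ᵇ_; _<_; _≤_; _≤?_; _<?_; z≤n; s≤s; s≤s⁻¹; z<s; s<s)
open import Data.Nat.ListAction using (sum)
open import Data.Nat.ListAction.Properties using (sum-++)
open import Data.Nat.Properties
open import Data.Nat.Tactic.RingSolver using (solve-∀)
open import Data.Product using (Σ; ∃; _×_; _,_; proj₁; proj₂)
open import Data.Sum using (_⊎_; inj₁; inj₂)
open import Data.Unit using (tt)
open import Function using (_∘_; id; const)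
open import Function.Bundles using (module Equivalence)
open import Relation.Binary.PropositionalEquality hiding ([_])
open import Relation.Binary using (tri<; tri≈; tri>)
open import Relation.Nullary using (yes; no; ¬_; contradiction)
open import Relation.Nullary.Decidable using (dec-true; dec-false)
open import Relation.Nullary.Decidable.Core using (T?)
import Algebra.Properties.CommutativeMonoid.Sum as MonoidSum
import Data.Vec.Functional as Vector

≡true⇒T : ∀ {b} → b ≡ true → T b
≡true⇒T = Equivalence.from T-≡

T⇒≡true : ∀ {b} → T b → b ≡ true
T⇒≡true = Equivalence.to T-≡

<⇒<ᵇ≡true : ∀ {m n} → m < n → (m <ᵇ n) ≡ true
<⇒<ᵇ≡true {m} {n} = dec-true (m <? n)

≥⇒<ᵇ≡false : ∀ {m n} → n ≤ m → (m <ᵇ n) ≡ false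
≥⇒<ᵇ≡false {m} {n} n≤m = dec-false (m <? n) (≤⇒≯ n≤m)

≤⇒≤ᵇ≡true : ∀ {m n} → m ≤ n → (m ≤ᵇ n) ≡ true
≤⇒≤ᵇ≡true {m} {n} = dec-true (m ≤? n)

>⇒≤ᵇ≡false : ∀ {m n} → n < m → (m ≤ᵇ n) ≡ false
>⇒≤ᵇ≡false {m} {n} n<m = dec-false (m ≤? n) (<⇒≱ n<m)

¬T⇒≡false : ∀ {b} → ¬ T b → b ≡ false
¬T⇒≡false {false} _  = refl
¬T⇒≡false {true}  ¬t = contradiction tt ¬t

module _ {A : Set} where

  filterᵇ-map : ∀ {B : Set} (p : B → Bool) (f : A → B) xs →
                filterᵇ p (map f xs) ≡ map f (filterᵇ (p ∘ f) xs)
  filterᵇ-map p f [] = refl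
  filterᵇ-map p f (x ∷ xs) with p (f x)
  ... | true  = cong (f x ∷_) (filterᵇ-map p f xs)
  ... | false = filterᵇ-map p f xs

  filterᵇ-cong : ∀ {p q : A → Bool} → (∀ x → p x ≡ q x) → ∀ xs → filterᵇ p xs ≡ filterᵇ q xs
  filterᵇ-cong p≡q = filter-≐ (T? ∘ _) (T? ∘ _) ((λ {x} → subst T (p≡q x)) , (λ {x} → subst T (sym (p≡q x))))

  length-filterᵇ-∷ʳ : ∀ (p : A → Bool) xs x →
                      length (filterᵇ p (xs ∷ʳ x)) ≡ length (filterᵇ p xs) + (if p x then 1 else 0)
  length-filterᵇ-∷ʳ p [] x with p x
  ... | true  = refl
  ... | false = refl
  length-filterᵇ-∷ʳ p (x′ ∷ xs) x with p x′
  ... | true  = cong suc (length-filterᵇ-∷ʳ p xs x)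
  ... | false = length-filterᵇ-∷ʳ p xs x

  sum-filterᵇ-mono : ∀ (f : A → ℕ) {p q : A → Bool} → (∀ x → T (p x) → T (q x)) →
                     ∀ xs → sum (map f (filterᵇ p xs)) ≤ sum (map f (filterᵇ q xs))
  sum-filterᵇ-mono f p⇒q [] = z≤n
  sum-filterᵇ-mono f {p} {q} p⇒q (x ∷ xs) with p x in px | q x in qx
  ... | true  | true  = +-monoʳ-≤ (f x) (sum-filterᵇ-mono f p⇒q xs)
  ... | false | true  = ≤-trans (sum-filterᵇ-mono f p⇒q xs) (m≤n+m _ (f x))
  ... | false | false = sum-filterᵇ-mono f p⇒q xs
  ... | true  | false = ⊥-elim (subst T qx (p⇒q x (≡true⇒T px)))

  sum-map-tabulate : ∀ {n} (f : A → ℕ) (g : Fin n → A) → sum (map f (tabulate g)) ≡ Vector.foldr _+_ 0 (f ∘ g)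
  sum-map-tabulate {zero}  f g = refl
  sum-map-tabulate {suc n} f g = cong (f (g zero) +_) (sum-map-tabulate f (g ∘ suc))

any-≡true : ∀ {A : Set} (p : A → Bool) {x xs} → x ∈ xs → p x ≡ true → any p xs ≡ true
any-≡true p x∈xs px = T⇒≡true (any⁺ p (Any.map (λ { refl → ≡true⇒T px }) x∈xs))

head-filterᵇ-applyUpTo : ∀ (P : ℕ → Bool) g N k → k < N → P (g k) ≡ true →
                         (∀ k′ → k′ < k → P (g k′) ≡ false) → head (filterᵇ P (applyUpTo g N)) ≡ just (g k)
head-filterᵇ-applyUpTo P g (suc N) zero    _   Pk _ rewrite Pk = refl
head-filterᵇ-applyUpTo P g (suc N) (suc k) k<N Pk earlier rewrite earlier 0 z<s =
  head-filterᵇ-applyUpTo P (g ∘ suc) N k (s≤s⁻¹ k<N) Pk (λ k′ k′<k → earlier (suc k′) (s<s k′<k))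

head-filterᵇ-applyUpTo⁻¹ : ∀ (P : ℕ → Bool) g N {q} → head (filterᵇ P (applyUpTo g N)) ≡ just q →
                           ∃ λ k → g k ≡ q × P (g k) ≡ true × (∀ k′ → k′ < k → P (g k′) ≡ false)
head-filterᵇ-applyUpTo⁻¹ P g (suc N) found with P (g 0) in P0
... | true with refl ← found = 0 , refl , P0 , λ _ ()
... | false with k , gk≡q , Pk , earlier ← head-filterᵇ-applyUpTo⁻¹ P (g ∘ suc) N found =
  suc k , gk≡q , Pk , λ { zero _ → P0 ; (suc k′) k′<k → earlier k′ (s≤s⁻¹ k′<k) }

head-filterᵇ-upTo⁻¹ : ∀ (P : ℕ → Bool) N {q} → head (filterᵇ P (upTo N)) ≡ just q →
                      P q ≡ true × (∀ q′ → P q′ ≡ true → q ≤ q′)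
head-filterᵇ-upTo⁻¹ P N found with k , refl , Pk , earlier ← head-filterᵇ-applyUpTo⁻¹ P id N found =
  Pk , λ q′ Pq′ → ≮⇒≥ (λ q′<k → contradiction (trans (sym (earlier q′ q′<k)) Pq′) λ ())

module IntervalCount (r A C : ℕ) (r+A≡C : r + A ≡ C) where

  inInterval : ℕ → Bool
  inInterval x = (r <ᵇ x) ∧ (x ≤ᵇ C)

  count : ℕ → ℕ
  count N = length (filterᵇ inInterval (upTo N))

  count-suc : ∀ N → count (suc N) ≡ count N + (if inInterval N then 1 else 0)
  count-suc N = trans (cong (length ∘ filterᵇ inInterval) (sym (upTo-∷ʳ N))) (length-filterᵇ-∷ʳ inInterval (upTo N) N)

  count-below : ∀ N → N ≤ suc r → count N ≡ 0
  count-below zero    _   = refl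
  count-below (suc N) N<1+r rewrite count-suc N | ≥⇒<ᵇ≡false {r} {N} (s≤s⁻¹ N<1+r) =
    trans (+-identityʳ _) (count-below N (m≤n⇒m≤1+n (s≤s⁻¹ N<1+r)))

  count-inside : ∀ d → d ≤ A → count (suc r + d) ≡ d
  count-inside zero    _   = trans (cong count (+-identityʳ (suc r))) (count-below (suc r) ≤-refl)
  count-inside (suc d) d<A = begin
    count (suc r + suc d)                       ≡⟨ cong count (+-suc (suc r) d) ⟩
    count (suc (suc r + d))                     ≡⟨ count-suc (suc r + d) ⟩
    count (suc r + d) + (if inInterval (suc r + d) then 1 else 0)
                                                ≡⟨ cong₂ _+_ (count-inside d (<⇒≤ d<A)) (cong (if_then 1 else 0) inside) ⟩
    d + 1                                       ≡⟨ +-comm d 1 ⟩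
    suc d                                       ∎
    where
    open ≡-Reasoning
    inside : inInterval (suc r + d) ≡ true
    inside = cong₂ _∧_ (<⇒<ᵇ≡true (s≤s (m≤m+n r d)))
                       (≤⇒≤ᵇ≡true (subst (suc r + d ≤_) r+A≡C (subst (_≤ r + A) (+-suc r d) (+-monoʳ-≤ r d<A))))

  count-above : ∀ e → count (suc C + e) ≡ A
  count-above zero    = trans (cong count (trans (+-identityʳ (suc C)) (cong suc (sym r+A≡C)))) (count-inside A ≤-refl)
  count-above (suc e) = begin
    count (suc C + suc e)                       ≡⟨ cong count (+-suc (suc C) e) ⟩
    count (suc (suc C + e))                     ≡⟨ count-suc (suc C + e) ⟩
    count (suc C + e) + (if inInterval (suc C + e) then 1 else 0)
                                                ≡⟨ cong₂ _+_ (count-above e) (cong (if_then 1 else 0) outside) ⟩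
    A + 0                                       ≡⟨ +-identityʳ A ⟩
    A                                           ∎
    where
    open ≡-Reasoning
    outside : inInterval (suc C + e) ≡ false
    outside = trans (cong ((r <ᵇ suc C + e) ∧_) (>⇒≤ᵇ≡false (s≤s (m≤m+n C e)))) (∧-zeroʳ _)

  count-upTo : ∀ N → C < N → count N ≡ A
  count-upTo N C<N with e , refl ← m≤n⇒∃[o]m+o≡n C<N = count-above e

-- Streets as segments

-- Segments occ E gs : the spots 1 … E, read from E downwards, split into
-- consecutive segments (t , l) of l spots whose occupancy is t.
data Segments (occ : ℕ → Bool) : ℕ → List (Bool × ℕ) → Set where
  []  : Segments occ 0 []
  _∷_ : ∀ {t l E gs} → (∀ s → E < s → s ≤ l + E → occ s ≡ t) → Segments occ E gs →
        Segments occ (l + E) ((t , l) ∷ gs)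

segment-∷ : ∀ {occ t l E F gs} → F ≡ l + E → (∀ s → E < s → s ≤ F → occ s ≡ t) → Segments occ E gs →
            Segments occ F ((t , l) ∷ gs)
segment-∷ refl occ≡t segs = occ≡t ∷ segs

segmentsLength : List (Bool × ℕ) → ℕ
segmentsLength gs = sum (map proj₂ gs)

Segments⇒≡segmentsLength : ∀ {occ E gs} → Segments occ E gs → E ≡ segmentsLength gs
Segments⇒≡segmentsLength []                     = refl
Segments⇒≡segmentsLength (_∷_ {l = l} _ segs) = cong (l +_) (Segments⇒≡segmentsLength segs)

data Alternating : Bool → List (Bool × ℕ) → Set where
  []  : ∀ {t} → Alternating t []
  _∷_ : ∀ {t l gs} → 1 ≤ l → Alternating (not t) gs → Alternating t ((t , l) ∷ gs)

alphas : List (Bool × ℕ) → List ℕ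
alphas gs = map proj₂ (filterᵇ (λ g → not (proj₁ g)) gs)

betas : List (Bool × ℕ) → List ℕ
betas gs = map proj₂ (filterᵇ proj₁ gs)

alphas-all-true : ∀ {gs} → All (λ g → proj₁ g ≡ true) gs → alphas gs ≡ []
alphas-all-true all-true = cong (map proj₂) (filter-none (T? ∘ _) (All.map (λ t≡true → subst (T ∘ not) t≡true) all-true))

module Runs {A : Set} (p : A → Bool) (f : A → ℕ) where

  segmentOf : A → Bool × ℕ
  segmentOf x = (p x , f x)

  runSegment : Bool × List A → Bool × ℕ
  runSegment g = (proj₁ g , sum (map f (proj₂ g)))

  Segments-runs : ∀ {occ E} xs → Segments occ E (map segmentOf xs) → Segments occ E (map runSegment (runs p xs))
  Segments-runs [] [] = []
  Segments-runs {occ} (x ∷ xs) (_∷_ {E = E} occ≡px segs) with runs p xs | Segments-runs xs segs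
  ... | []           | [] = segment-∷ (cong (_+ 0) (sym (+-identityʳ (f x)))) occ≡px []
  ... | (b , g) ∷ gs | segs′ with p x Bool.≟ b
  ... | no _ = segment-∷ (cong (_+ E) (sym (+-identityʳ (f x)))) occ≡px segs′
  Segments-runs {occ} (x ∷ xs) (_∷_ occ≡px _) | (b , g) ∷ gs | _∷_ {E = E′} occ≡b segs′ | yes px≡b =
    segment-∷ (sym (+-assoc (f x) _ E′)) merged segs′
    where
    merged : ∀ s → E′ < s → s ≤ f x + (sum (map f g) + E′) → occ s ≡ b
    merged s E′<s s≤ with s ≤? sum (map f g) + E′
    ... | yes s≤g = occ≡b s E′<s s≤g
    ... | no  s>g = trans (occ≡px s (≰⇒> s>g) s≤) px≡b

  Alternating-runs : (∀ x → 1 ≤ f x) → ∀ x xs → Alternating (p x) (map runSegment (runs p (x ∷ xs)))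
  Alternating-runs f≥1 x [] = ≤-trans (f≥1 x) (≤-reflexive (sym (+-identityʳ (f x)))) ∷ []
  Alternating-runs f≥1 x (x′ ∷ xs) with runs p (x′ ∷ xs) | Alternating-runs f≥1 x′ xs
  ... | []           | _ = ≤-trans (f≥1 x) (≤-reflexive (sym (+-identityʳ (f x)))) ∷ []
  ... | (b , g) ∷ gs | l≥1 ∷ alt with p x Bool.≟ b
  ... | yes px≡b rewrite px≡b = ≤-trans (f≥1 x) (m≤m+n (f x) _) ∷ alt
  ... | no px≢b  = ≤-trans (f≥1 x) (≤-reflexive (sym (+-identityʳ (f x))))
                   ∷ subst (λ t → Alternating t _) (¬-not (px≢b ∘ sym)) (l≥1 ∷ alt)

  runs-all-true : ∀ xs → All (λ x → p x ≡ true) xs → All (λ g → proj₁ g ≡ true) (runs p xs)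
  runs-all-true [] [] = []
  runs-all-true (x ∷ xs) (px ∷ pxs) with runs p xs | runs-all-true xs pxs
  ... | []           | [] = px ∷ []
  ... | (b , g) ∷ gs | b≡true ∷ rest with p x Bool.≟ b
  ... | yes _ = b≡true ∷ rest
  ... | no  _ = px ∷ b≡true ∷ rest

module PrefCount (Y : ℕ) where

  prefCount : List (Bool × ℕ) → ℕ
  prefCount []                          = 1
  prefCount ((false , _) ∷ _)           = 1
  prefCount ((true , b) ∷ [])           = b + 1
  prefCount ((true , b) ∷ (_ , a) ∷ gs) = if Y ≤ᵇ a then b + Y else b + a + prefCount gs

  prefCount-long : ∀ {b a gs} → Y ≤ a → prefCount ((true , b) ∷ (false , a) ∷ gs) ≡ b + Y
  prefCount-long Y≤a rewrite ≤⇒≤ᵇ≡true Y≤a = refl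

  prefCount-short : ∀ {b a gs} → a < Y → prefCount ((true , b) ∷ (false , a) ∷ gs) ≡ b + a + prefCount gs
  prefCount-short a<Y rewrite >⇒≤ᵇ≡false a<Y = refl

  prefCount-free-first : ∀ {gs} → Alternating false gs → prefCount gs ≡ 1
  prefCount-free-first []      = refl
  prefCount-free-first (_ ∷ _) = refl

  prefCount-all-short : ∀ {gs} → Alternating true gs → (∀ j → lookup (alphas gs) j < Y) →
                        prefCount gs ≡ suc (segmentsLength gs)
  prefCount-all-short [] _ = refl
  prefCount-all-short {(true , b) ∷ []} (_ ∷ []) _ = trans (+-comm b 1) (cong suc (sym (+-identityʳ b)))
  prefCount-all-short {(true , b) ∷ (false , a) ∷ gs} (_ ∷ _ ∷ alt) short = begin
    prefCount ((true , b) ∷ (false , a) ∷ gs) ≡⟨ prefCount-short {gs = gs} (short zero) ⟩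
    b + a + prefCount gs                      ≡⟨ cong (b + a +_) (prefCount-all-short alt (short ∘ suc)) ⟩
    b + a + suc (segmentsLength gs)           ≡⟨ rearrange b a (segmentsLength gs) ⟩
    suc (b + (a + segmentsLength gs))         ∎
    where
    open ≡-Reasoning
    rearrange : ∀ b a S → b + a + suc S ≡ suc (b + (a + S))
    rearrange = solve-∀

  prefCount-first-long : ∀ {gs} → Alternating true gs → (m : Fin (length (alphas gs))) → Y ≤ lookup (alphas gs) m →
                         (∀ j → toℕ j < toℕ m → lookup (alphas gs) j < Y) →
                         prefCount gs ≡ Y + sum (take (suc (toℕ m)) (betas gs)) + sum (take (toℕ m) (alphas gs))
  prefCount-first-long {(true , b) ∷ (false , a) ∷ gs} (_ ∷ _ ∷ alt) zero Y≤a _ =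
    trans (prefCount-long {gs = gs} Y≤a) (rearrange b Y)
    where
    rearrange : ∀ b Y → b + Y ≡ Y + (b + 0) + 0
    rearrange = solve-∀
  prefCount-first-long {(true , b) ∷ (false , a) ∷ gs} (_ ∷ _ ∷ alt) (suc m) long short = begin
    prefCount ((true , b) ∷ (false , a) ∷ gs) ≡⟨ prefCount-short {gs = gs} (short zero z<s) ⟩
    b + a + prefCount gs                      ≡⟨ cong (b + a +_) (prefCount-first-long alt m long λ j → short (suc j) ∘ s<s) ⟩
    b + a + (Y + βs + αs)                     ≡⟨ rearrange b a Y βs αs ⟩
    Y + (b + βs) + (a + αs)                   ∎
    where
    open ≡-Reasoning
    βs = sum (take (suc (toℕ m)) (betas gs))
    αs = sum (take (toℕ m) (alphas gs))
    rearrange : ∀ b a Y B A → b + a + (Y + B + A) ≡ Y + (b + B) + (a + A)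
    rearrange = solve-∀

module FreeBlocks (occ : ℕ → Bool) {Y : ℕ} (Y≥1 : 1 ≤ Y) where

  open PrefCount Y

  FreeFrom : ℕ → Set
  FreeFrom q = ∀ t → t < Y → occ (q + t) ≡ false

  Blocked : ℕ → Set
  Blocked q = ∃ λ t → t < Y × occ (q + t) ≡ true

  -- start is the last spot ≤ E at which Y free spots begin, or 0 if there is none.
  record LastFreeBlock (E A : ℕ) : Set where
    field
      start       : ℕ
      start≤E     : start ≤ E
      start+A≡1+E : start + A ≡ suc E
      start-free  : 1 ≤ start → FreeFrom start
      blocked     : ∀ q → 1 ≤ q → start < q → q ≤ E → Blocked q

  blocked-at : ∀ {q s} → q ≤ s → s < q + Y → occ s ≡ true → Blocked q
  blocked-at {q} {s} q≤s s<q+Y occ-s =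
    s ∸ q , +-cancelˡ-< q (s ∸ q) Y (subst (_< q + Y) (sym q+[s∸q]≡s) s<q+Y)
          , subst (λ u → occ u ≡ true) (sym q+[s∸q]≡s) occ-s
    where
    q+[s∸q]≡s : q + (s ∸ q) ≡ s
    q+[s∸q]≡s = m+[n∸m]≡n q≤s

  blocked-reaching : ∀ {b E q} → 1 ≤ b → (∀ s → E < s → s ≤ b + E → occ s ≡ true) →
                     q ≤ b + E → suc E < q + Y → Blocked q
  blocked-reaching {b} {E} {q} b≥1 occupied q≤b+E reach with E <? q
  ... | yes E<q = blocked-at ≤-refl (m<m+n q Y≥1) (occupied q E<q q≤b+E)
  ... | no  E≮q = blocked-at (m≤n⇒m≤1+n (≮⇒≥ E≮q)) reach (occupied (suc E) ≤-refl (+-monoˡ-≤ E b≥1))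

  last-inside-free : ∀ {b a E} → 1 ≤ b → Y ≤ a → (∀ s → a + E < s → s ≤ b + (a + E) → occ s ≡ true) →
                     (∀ s → E < s → s ≤ a + E → occ s ≡ false) → LastFreeBlock (b + (a + E)) (b + Y)
  last-inside-free {b} {_} {E} b≥1 Y≤a occupied free with d , refl ← m≤n⇒∃[o]m+o≡n Y≤a = record
    { start       = suc (d + E)
    ; start≤E     = ≤-trans (+-monoˡ-≤ E (+-monoˡ-≤ d Y≥1)) (m≤n+m _ b)
    ; start+A≡1+E = rearrange d E b Y
    ; start-free  = λ _ t t<Y → free (suc (d + E) + t) (s≤s (≤-trans (m≤n+m E d) (m≤m+n _ t))) (fits t t<Y)
    ; blocked     = λ q _ start<q q≤ → blocked-reaching b≥1 occupied q≤ (reaches q start<q)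
    }
    where
    rearrange : ∀ d E b Y → suc (d + E) + (b + Y) ≡ suc (b + (Y + d + E))
    rearrange = solve-∀
    shift : ∀ d E t → suc (d + E) + t ≡ suc t + d + E
    shift = solve-∀
    fits : ∀ t → t < Y → suc (d + E) + t ≤ Y + d + E
    fits t t<Y = begin
      suc (d + E) + t ≡⟨ shift d E t ⟩
      suc t + d + E   ≤⟨ +-monoˡ-≤ E (+-monoˡ-≤ d t<Y) ⟩
      Y + d + E       ∎
      where open ≤-Reasoning
    shift′ : ∀ Y d E → suc (suc (Y + d + E)) ≡ suc (suc (d + E)) + Y
    shift′ = solve-∀
    reaches : ∀ q → suc (d + E) < q → suc (Y + d + E) < q + Y
    reaches q start<q = begin-strict
      suc (Y + d + E)       <⟨ n<1+n _ ⟩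
      suc (suc (Y + d + E)) ≡⟨ shift′ Y d E ⟩
      suc (suc (d + E)) + Y ≤⟨ +-monoˡ-≤ Y start<q ⟩
      q + Y                 ∎
      where open ≤-Reasoning

  last-below-free : ∀ {b a E A} → 1 ≤ b → a < Y → (∀ s → a + E < s → s ≤ b + (a + E) → occ s ≡ true) →
                    LastFreeBlock E A → LastFreeBlock (b + (a + E)) (b + a + A)
  last-below-free {b} {a} {E} {A} b≥1 a<Y occupied last = record
    { start       = start
    ; start≤E     = ≤-trans start≤E (≤-trans (m≤n+m E a) (m≤n+m _ b))
    ; start+A≡1+E = begin
        start + (b + a + A) ≡⟨ rearrange start b a A ⟩
        b + a + (start + A) ≡⟨ cong (b + a +_) start+A≡1+E ⟩
        b + a + suc E       ≡⟨ rearrange′ b a E ⟩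
        suc (b + (a + E))   ∎
    ; start-free  = start-free
    ; blocked     = blocked′
    }
    where
    open LastFreeBlock last
    open ≡-Reasoning
    rearrange : ∀ s b a A → s + (b + a + A) ≡ b + a + (s + A)
    rearrange = solve-∀
    rearrange′ : ∀ b a E → b + a + suc E ≡ suc (b + (a + E))
    rearrange′ = solve-∀
    shift : ∀ a E → suc E + suc a ≡ suc (suc (a + E))
    shift = solve-∀
    blocked′ : ∀ q → 1 ≤ q → start < q → q ≤ b + (a + E) → Blocked q
    blocked′ q q≥1 start<q q≤ with E <? q
    ... | no  E≮q = blocked q q≥1 start<q (≮⇒≥ E≮q)
    ... | yes E<q = blocked-reaching b≥1 occupied q≤ (subst (_≤ q + Y) (shift a E) (+-mono-≤ E<q a<Y))

  lastFreeBlock-occupied-first : ∀ {E gs} → Segments occ E gs → Alternating true gs → LastFreeBlock E (prefCount gs)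
  lastFreeBlock-occupied-first [] [] = record
    { start       = 0
    ; start≤E     = z≤n
    ; start+A≡1+E = refl
    ; start-free  = λ ()
    ; blocked     = λ q q≥1 _ q≤0 → contradiction q≤0 (<⇒≱ q≥1)
    }
  lastFreeBlock-occupied-first {gs = (true , b) ∷ []} (occupied ∷ []) (_ ∷ []) = record
    { start       = 0
    ; start≤E     = z≤n
    ; start+A≡1+E = trans (+-comm b 1) (cong suc (sym (+-identityʳ b)))
    ; start-free  = λ ()
    ; blocked     = λ q q≥1 _ q≤b → blocked-at ≤-refl (m<m+n q Y≥1) (occupied q q≥1 q≤b)
    }
  lastFreeBlock-occupied-first {gs = (true , b) ∷ (false , a) ∷ gs} (occupied ∷ (free ∷ segs)) (b≥1 ∷ _ ∷ alt) with Y ≤? a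
  ... | yes Y≤a = subst (LastFreeBlock _) (sym (prefCount-long {gs = gs} Y≤a)) (last-inside-free b≥1 Y≤a occupied free)
  ... | no  Y≰a = subst (LastFreeBlock _) (sym (prefCount-short {gs = gs} (≰⇒> Y≰a)))
                    (last-below-free b≥1 (≰⇒> Y≰a) occupied (lastFreeBlock-occupied-first segs alt))

  lastFreeBlock : ∀ {t E gs} → FreeFrom (suc E) → Segments occ E gs → Alternating t gs → LastFreeBlock E (prefCount gs)
  lastFreeBlock {true}  _ segs alt = lastFreeBlock-occupied-first segs alt
  lastFreeBlock {false} _ [] []    = lastFreeBlock-occupied-first [] []
  lastFreeBlock {false} {E} free-above (_∷_ {E = E′} free segs) (a≥1 ∷ _) = record
    { start       = E
    ; start≤E     = ≤-refl
    ; start+A≡1+E = +-comm E 1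
    ; start-free  = λ _ → free-from-E
    ; blocked     = λ q _ E<q q≤E → contradiction q≤E (<⇒≱ E<q)
    }
    where
    free-from-E : FreeFrom E
    free-from-E zero    _   = free (E + 0) (subst (E′ <_) (sym (+-identityʳ E)) (+-monoˡ-≤ E′ a≥1))
                                           (≤-reflexive (+-identityʳ E))
    free-from-E (suc t) t<Y = trans (cong occ (+-suc E t)) (free-above t (<-trans (n<1+n t) t<Y))

-- Parking assortments

predecessor : ∀ {n} (k : Fin n) → 1 ≤ toℕ k → ∃ λ (k′ : Fin n) → suc (toℕ k′) ≡ toℕ k
predecessor (suc k) _ = inject₁ k , cong suc (toℕ-inject₁ k)

indicesBelow : ∀ n → ℕ → List (Fin n)
indicesBelow n j = filterᵇ (λ k → toℕ k <ᵇ j) (allFin n)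

indicesBelow-zero : ∀ n → indicesBelow n 0 ≡ []
indicesBelow-zero n = filter-none (T? ∘ _) (All.universal (λ _ ()) (allFin n))

indicesBelow-suc-suc : ∀ n j → indicesBelow (suc n) (suc j) ≡ zero ∷ map suc (indicesBelow n j)
indicesBelow-suc-suc n j = cong (zero ∷_) (trans (cong (filterᵇ _) (sym (map-tabulate id suc))) (filterᵇ-map _ suc (allFin n)))

indicesBelow-suc : ∀ {n} (k : Fin n) → indicesBelow n (suc (toℕ k)) ≡ indicesBelow n (toℕ k) ++ [ k ]
indicesBelow-suc {suc n} zero = begin
  indicesBelow (suc n) 1             ≡⟨ indicesBelow-suc-suc n 0 ⟩
  zero ∷ map suc (indicesBelow n 0)  ≡⟨ cong (λ ks → zero ∷ map suc ks) (indicesBelow-zero n) ⟩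
  [ zero ]                           ≡⟨ cong (_++ [ zero ]) (indicesBelow-zero (suc n)) ⟨
  indicesBelow (suc n) 0 ++ [ zero ] ∎
  where open ≡-Reasoning
indicesBelow-suc {suc n} (suc k) = begin
  indicesBelow (suc n) (suc (suc (toℕ k)))              ≡⟨ indicesBelow-suc-suc n (suc (toℕ k)) ⟩
  zero ∷ map suc (indicesBelow n (suc (toℕ k)))         ≡⟨ cong (λ ks → zero ∷ map suc ks) (indicesBelow-suc k) ⟩
  zero ∷ map suc (indicesBelow n (toℕ k) ++ [ k ])      ≡⟨ cong (zero ∷_) (map-++ suc (indicesBelow n (toℕ k)) [ k ]) ⟩
  zero ∷ map suc (indicesBelow n (toℕ k)) ++ [ suc k ]  ≡⟨ cong (_++ [ suc k ]) (indicesBelow-suc-suc n (toℕ k)) ⟨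
  indicesBelow (suc n) (suc (toℕ k)) ++ [ suc k ]       ∎
  where open ≡-Reasoning

module Street {n : ℕ} (σ : Permutation′ n) (y : Fin n → ℕ) (y≥1 : ∀ c → 1 ≤ y c) where

  positionsBefore-suc : ∀ {k k′} → suc (toℕ k′) ≡ toℕ k → positionsBefore σ y k ≡ positionsBefore σ y k′ ++ [ k′ ]
  positionsBefore-suc {k′ = k′} 1+k′≡k = trans (cong (indicesBelow n) (sym 1+k′≡k)) (indicesBelow-suc k′)

  reverse-positionsBefore-suc : ∀ {k k′} → suc (toℕ k′) ≡ toℕ k →
                                reverse (positionsBefore σ y k) ≡ k′ ∷ reverse (positionsBefore σ y k′)
  reverse-positionsBefore-suc {k′ = k′} 1+k′≡k =
    trans (cong reverse (positionsBefore-suc 1+k′≡k)) (reverse-++ (positionsBefore σ y k′) [ k′ ])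

  before+len≡ : ∀ k → before σ y k + len σ y k ≡ sum (map (len σ y) (indicesBelow n (suc (toℕ k))))
  before+len≡ k = begin
    before σ y k + len σ y k                  ≡⟨ cong (before σ y k +_) (+-identityʳ (len σ y k)) ⟨
    sum (map L ks) + sum [ len σ y k ]        ≡⟨ sum-++ (map L ks) _ ⟨
    sum (map L ks ++ [ len σ y k ])           ≡⟨ cong sum (map-++ L ks [ k ]) ⟨
    sum (map L (ks ++ [ k ]))                 ≡⟨ cong (sum ∘ map L) (indicesBelow-suc k) ⟨
    sum (map L (indicesBelow n (suc (toℕ k)))) ∎
    where
    open ≡-Reasoning
    L = len σ y
    ks = positionsBefore σ y k

  before-suc : ∀ {k k′} → suc (toℕ k′) ≡ toℕ k → before σ y k ≡ before σ y k′ + len σ y k′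
  before-suc {k} {k′} 1+k′≡k = trans (cong (sum ∘ map (len σ y) ∘ indicesBelow n) (sym 1+k′≡k)) (sym (before+len≡ k′))

  before-mono : ∀ {a b} → toℕ a < toℕ b → before σ y a + len σ y a ≤ before σ y b
  before-mono {a} {b} a<b = begin
    before σ y a + len σ y a                           ≡⟨ before+len≡ a ⟩
    sum (map (len σ y) (indicesBelow n (suc (toℕ a))))
      ≤⟨ sum-filterᵇ-mono (len σ y) (λ _ t → <⇒<ᵇ (<-≤-trans (<ᵇ⇒< _ _ t) a<b)) (allFin n) ⟩
    before σ y b                                       ∎
    where open ≤-Reasoning

  before+len≤totalLength : ∀ k → before σ y k + len σ y k ≤ totalLength σ y
  before+len≤totalLength k = begin
    before σ y k + len σ y k                    ≡⟨ before+len≡ k ⟩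
    sum (map L (indicesBelow n (suc (toℕ k))))  ≤⟨ sum-filterᵇ-mono L (λ _ _ → tt) (allFin n) ⟩
    sum (map L (filterᵇ (const true) (allFin n)))
      ≡⟨ cong (sum ∘ map L) (filter-all (T? ∘ const true) (All.universal (const tt) (allFin n))) ⟩
    sum (map L (allFin n))                      ≡⟨ sum-map-tabulate L id ⟩
    Vector.foldr _+_ 0 L                        ≡⟨ MonoidSum.sum-permute +-0-commutativeMonoid y σ ⟨
    Vector.foldr _+_ 0 y                        ≡⟨ sum-map-tabulate y id ⟨
    totalLength σ y                             ∎
    where
    open ≤-Reasoning
    L = len σ y

  module At (i : Fin n) where

    Y : ℕ
    Y = len σ y i

    B : ℕ
    B = before σ y i

    occ : ℕ → Bool
    occ = occupied σ y i

    smaller : Fin n → Bool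
    smaller k = toℕ (car σ y k) <ᵇ toℕ (car σ y i)

    occupies : ℕ → Fin n → Bool
    occupies s k = smaller k ∧ ((before σ y k <ᵇ s) ∧ (s ≤ᵇ before σ y k + len σ y k))

    open Runs smaller (len σ y)
    open PrefCount Y
    open FreeBlocks occ (y≥1 (car σ y i))

    occupied-spot : ∀ k s → before σ y k < s → s ≤ before σ y k + len σ y k → occ s ≡ smaller k
    occupied-spot k s lo hi with smaller k in smaller-k
    ... | true  =
      any-≡true (occupies s) (∈-allFin k) (cong₂ _∧_ smaller-k (cong₂ _∧_ (<⇒<ᵇ≡true lo) (≤⇒≤ᵇ≡true hi)))
    ... | false = ¬T⇒≡false λ some-occupies →
      let x , x-occupies = Any.satisfied (any⁻ (occupies s) (allFin n) some-occupies) in subst T (not-occupying x) x-occupies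
      where
      not-occupying : ∀ x → occupies s x ≡ false
      not-occupying x with <-cmp (toℕ x) (toℕ k)
      ... | tri< x<k _ _ rewrite >⇒≤ᵇ≡false (≤-<-trans (before-mono x<k) lo) =
        trans (cong (smaller x ∧_) (∧-zeroʳ _)) (∧-zeroʳ _)
      ... | tri≈ _ x≡k _ rewrite toℕ-injective x≡k | smaller-k = refl
      ... | tri> _ _ k<x rewrite ≥⇒<ᵇ≡false (≤-trans hi (before-mono k<x)) = ∧-zeroʳ _

    Segments-positionsBefore : ∀ j k → toℕ k ≡ j →
                               Segments occ (before σ y k) (map segmentOf (reverse (positionsBefore σ y k)))
    Segments-positionsBefore zero k k≡0 rewrite k≡0 | indicesBelow-zero n = []
    Segments-positionsBefore (suc j) k k≡1+j with k′ , 1+k′≡k ← predecessor k (subst (1 ≤_) (sym k≡1+j) (s≤s z≤n)) =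
      subst (Segments occ (before σ y k) ∘ map segmentOf) (sym (reverse-positionsBefore-suc 1+k′≡k))
        (segment-∷ (trans (before-suc 1+k′≡k) (+-comm (before σ y k′) (len σ y k′)))
                   (λ s lo hi → occupied-spot k′ s lo (subst (s ≤_) (before-suc 1+k′≡k) hi))
                   (Segments-positionsBefore j k′ (suc-injective (trans 1+k′≡k k≡1+j))))

    blockSegments : List (Bool × ℕ)
    blockSegments = map runSegment (blocks σ y i)

    Segments-blocks : Segments occ B blockSegments
    Segments-blocks = Segments-runs _ (Segments-positionsBefore (toℕ i) i refl)

    Alternating-blocks-suc : ∀ {j} → suc (toℕ j) ≡ toℕ i → Alternating (smaller j) blockSegments
    Alternating-blocks-suc {j} 1+j≡i =
      subst (Alternating (smaller j) ∘ map runSegment ∘ runs smaller) (sym (reverse-positionsBefore-suc 1+j≡i))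
        (Alternating-runs (y≥1 ∘ car σ y) j (reverse (positionsBefore σ y j)))

    blocks-zero : toℕ i ≡ 0 → blockSegments ≡ []
    blocks-zero i≡0 = cong (map runSegment ∘ runs smaller ∘ reverse) (trans (cong (indicesBelow n) i≡0) (indicesBelow-zero n))

    Alternating-blocks : ∃ λ t → Alternating t blockSegments
    Alternating-blocks with toℕ i ≟ 0
    ... | yes i≡0 = true , subst (Alternating true) (sym (blocks-zero i≡0)) []
    ... | no  i≢0 with j , 1+j≡i ← predecessor i (n≢0⇒n>0 i≢0) = smaller j , Alternating-blocks-suc 1+j≡i

    own-spots-free : FreeFrom (suc B)
    own-spots-free t t<Y = trans (occupied-spot i (suc B + t) (s≤s (m≤m+n B t)) (subst (_≤ B + Y) (+-suc B t) (+-monoʳ-≤ B t<Y)))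
                             (≥⇒<ᵇ≡false {toℕ (car σ y i)} ≤-refl)

    freeBlock-true : ∀ q → 1 ≤ q → q + Y ≤ suc (totalLength σ y) → FreeFrom q → freeBlock σ y i q ≡ true
    freeBlock-true q q≥1 fits free = cong₂ _∧_ (≤⇒≤ᵇ≡true q≥1) (cong₂ _∧_ (≤⇒≤ᵇ≡true fits)
      (T⇒≡true (all⁻ _ (applyUpTo⁺₁ id Y (λ t<Y → ≡true⇒T (cong not (free _ t<Y)))))))

    freeBlock-false : ∀ q → Blocked q → freeBlock σ y i q ≡ false
    freeBlock-false q (t , t<Y , occupied-t) = begin
      (1 ≤ᵇ q) ∧ ((q + Y ≤ᵇ suc (totalLength σ y)) ∧ all (λ t → not (occ (q + t))) (upTo Y))
        ≡⟨ cong (λ b → (1 ≤ᵇ q) ∧ ((q + Y ≤ᵇ suc (totalLength σ y)) ∧ b)) (¬T⇒≡false not-all-free) ⟩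
      (1 ≤ᵇ q) ∧ ((q + Y ≤ᵇ suc (totalLength σ y)) ∧ false)
        ≡⟨ trans (cong ((1 ≤ᵇ q) ∧_) (∧-zeroʳ _)) (∧-zeroʳ _) ⟩
      false ∎
      where
      open ≡-Reasoning
      not-all-free : ¬ T (all (λ t → not (occ (q + t))) (upTo Y))
      not-all-free all-free = subst (T ∘ not) occupied-t (All.lookup (all⁺ _ _ all-free) (∈-upTo⁺ t<Y))

    candidate : ℕ → ℕ → Bool
    candidate x q = (x ≤ᵇ q) ∧ freeBlock σ y i q

    isPref-true : ∀ {x} → parkAt σ y i x ≡ just (suc B) → isPref σ y i x ≡ true
    isPref-true {x} parks with parkAt σ y i x | parks
    ... | just _ | refl = dec-true (suc B ≟ suc B) refl

    isPref-false : ∀ {x} → (∀ q → parkAt σ y i x ≡ just q → q ≢ suc B) → isPref σ y i x ≡ false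
    isPref-false {x} elsewhere with parkAt σ y i x | elsewhere
    ... | just q  | elsewhere′ = dec-false (q ≟ suc B) (elsewhere′ q refl)
    ... | nothing | _          = refl

    parkAt-at-or-after : ∀ x {q} → parkAt σ y i x ≡ just q → x ≤ q
    parkAt-at-or-after x {q} parks =
      ≤ᵇ⇒≤ x q (proj₁ (Equivalence.to T-∧ (≡true⇒T (proj₁ (head-filterᵇ-upTo⁻¹ (candidate x) _ parks)))))

    parkAt-at-or-before : ∀ x q₀ {q} → x ≤ q₀ → freeBlock σ y i q₀ ≡ true → parkAt σ y i x ≡ just q → q ≤ q₀
    parkAt-at-or-before x q₀ x≤q₀ free parks =
      proj₂ (head-filterᵇ-upTo⁻¹ (candidate x) _ parks) q₀ (cong₂ _∧_ (≤⇒≤ᵇ≡true x≤q₀) free)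

    parkAt-first : ∀ x q₀ → x ≤ q₀ → q₀ ≤ totalLength σ y → freeBlock σ y i q₀ ≡ true →
                   (∀ q → x ≤ q → q < q₀ → freeBlock σ y i q ≡ false) → parkAt σ y i x ≡ just q₀
    parkAt-first x q₀ x≤q₀ q₀≤m free earlier-blocked =
      head-filterᵇ-applyUpTo (candidate x) id _ q₀ (s≤s q₀≤m) (cong₂ _∧_ (≤⇒≤ᵇ≡true x≤q₀) free) earlier
      where
      earlier : ∀ q → q < q₀ → candidate x q ≡ false
      earlier q q<q₀ with x ≤? q
      ... | no  x≰q = cong (_∧ freeBlock σ y i q) (>⇒≤ᵇ≡false (≰⇒> x≰q))
      ... | yes x≤q = trans (cong ((x ≤ᵇ q) ∧_) (earlier-blocked q x≤q q<q₀)) (∧-zeroʳ _)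

    LastFreeBlock⇒length-Pref : ∀ {A} → LastFreeBlock B A → length (Pref σ y i) ≡ A
    LastFreeBlock⇒length-Pref {A} last =
      trans (cong length (filterᵇ-cong prefers (upTo (suc (totalLength σ y))))) (count-upTo _ (s≤s 1+B≤m))
      where
      open LastFreeBlock last
      open IntervalCount start A (suc B) start+A≡1+E

      1+B≤m : suc B ≤ totalLength σ y
      1+B≤m = ≤-trans (m<m+n B (y≥1 (car σ y i))) (before+len≤totalLength i)

      free-1+B : freeBlock σ y i (suc B) ≡ true
      free-1+B = freeBlock-true (suc B) (s≤s z≤n) (s≤s (before+len≤totalLength i)) own-spots-free

      free-start : 1 ≤ start → freeBlock σ y i start ≡ true
      free-start start≥1 =
        freeBlock-true start start≥1 (m≤n⇒m≤1+n (≤-trans (+-monoˡ-≤ Y start≤E) (before+len≤totalLength i)))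
                       (start-free start≥1)

      parks-at-1+B : ∀ x → start < x → x ≤ suc B → parkAt σ y i x ≡ just (suc B)
      parks-at-1+B x start<x x≤1+B = parkAt-first x (suc B) x≤1+B 1+B≤m free-1+B λ q x≤q q<1+B →
        let start<q = <-≤-trans start<x x≤q in
        freeBlock-false q (blocked q (≤-trans (s≤s z≤n) start<q) start<q (s≤s⁻¹ q<1+B))

      prefers : ∀ x → ((1 ≤ᵇ x) ∧ isPref σ y i x) ≡ inInterval x
      prefers zero = refl
      prefers (suc x) with start <? suc x | suc x ≤? suc B
      ... | yes start<x | yes x≤1+B =
        trans (isPref-true {suc x} (parks-at-1+B (suc x) start<x x≤1+B))
              (sym (cong₂ _∧_ (<⇒<ᵇ≡true start<x) (≤⇒≤ᵇ≡true x≤1+B)))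
      ... | _           | no  x≰1+B =
        trans (isPref-false {suc x} λ q parks q≡1+B → x≰1+B (subst (suc x ≤_) q≡1+B (parkAt-at-or-after (suc x) parks)))
              (sym (trans (cong ((start <ᵇ suc x) ∧_) (>⇒≤ᵇ≡false (≰⇒> x≰1+B))) (∧-zeroʳ _)))
      ... | no  start≮x | yes _ =
        let x≤start = ≮⇒≥ start≮x in
        trans (isPref-false {suc x} λ q parks q≡1+B → <⇒≱ (s≤s start≤E)
                 (subst (_≤ start) q≡1+B
                   (parkAt-at-or-before (suc x) start x≤start (free-start (≤-trans (s≤s z≤n) x≤start)) parks)))
              (sym (cong (_∧ (suc x ≤ᵇ suc B)) (≥⇒<ᵇ≡false x≤start)))

    length-Pref≡prefCount : length (Pref σ y i) ≡ prefCount blockSegments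
    length-Pref≡prefCount with _ , alt ← Alternating-blocks =
      LastFreeBlock⇒length-Pref (lastFreeBlock own-spots-free Segments-blocks alt)

    alphaLengths≡alphas : alphaLengths σ y i ≡ alphas blockSegments
    alphaLengths≡alphas = sym (trans (cong (map proj₂) (filterᵇ-map _ runSegment (blocks σ y i))) (sym (map-∘ _)))

    betaLengths≡betas : betaLengths σ y i ≡ betas blockSegments
    betaLengths≡betas = sym (trans (cong (map proj₂) (filterᵇ-map _ runSegment (blocks σ y i))) (sym (map-∘ _)))

    length-Pref-first : toℕ i ≡ 0 → length (Pref σ y i) ≡ 1
    length-Pref-first i≡0 = trans length-Pref≡prefCount (cong prefCount (blocks-zero i≡0))

    length-Pref-after-larger : ∀ j → suc (toℕ j) ≡ toℕ i → toℕ (car σ y i) < toℕ (car σ y j) →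
                               length (Pref σ y i) ≡ 1
    length-Pref-after-larger j 1+j≡i σi<σj = trans length-Pref≡prefCount (prefCount-free-first
      (subst (λ t → Alternating t blockSegments) (≥⇒<ᵇ≡false (<⇒≤ σi<σj)) (Alternating-blocks-suc 1+j≡i)))

    Alternating-after-smaller : ∀ {j} → suc (toℕ j) ≡ toℕ i → toℕ (car σ y j) < toℕ (car σ y i) →
                                Alternating true blockSegments
    Alternating-after-smaller 1+j≡i σj<σi =
      subst (λ t → Alternating t blockSegments) (<⇒<ᵇ≡true σj<σi) (Alternating-blocks-suc 1+j≡i)

    LengthIfAllShort : List ℕ → Set
    LengthIfAllShort as = (∀ j → lookup as j < Y) → length (Pref σ y i) ≡ 1 + B

    length-Pref-all-short : Alternating true blockSegments → LengthIfAllShort (alphaLengths σ y i)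
    length-Pref-all-short alt = subst LengthIfAllShort (sym alphaLengths≡alphas) λ short →
      trans length-Pref≡prefCount
            (trans (prefCount-all-short alt short) (cong suc (sym (Segments⇒≡segmentsLength Segments-blocks))))

    LengthIfFirstLong : List ℕ → List ℕ → Set
    LengthIfFirstLong as bs = ∀ (m : Fin (length as)) → Y ≤ lookup as m → (∀ j → toℕ j < toℕ m → lookup as j < Y) →
                             length (Pref σ y i) ≡ Y + sum (take (suc (toℕ m)) bs) + sum (take (toℕ m) as)

    length-Pref-first-long : Alternating true blockSegments → LengthIfFirstLong (alphaLengths σ y i) (betaLengths σ y i)
    length-Pref-first-long alt =
      subst₂ LengthIfFirstLong (sym alphaLengths≡alphas) (sym betaLengths≡betas) λ m long short →
        trans length-Pref≡prefCount (prefCount-first-long alt m long short)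

    length-Pref-after-all-smaller : 1 ≤ toℕ i → (∀ j → toℕ j < toℕ i → toℕ (car σ y j) < toℕ (car σ y i)) →
                                    length (Pref σ y i) ≡ 1 + B
    length-Pref-after-all-smaller i≥1 all-smaller with j , 1+j≡i ← predecessor i i≥1 =
      length-Pref-all-short (Alternating-after-smaller 1+j≡i (all-smaller j (≤-reflexive 1+j≡i)))
        (subst (λ as → ∀ j → lookup as j < Y) (sym (trans alphaLengths≡alphas no-alphas)) λ ())
      where
      no-alphas : alphas blockSegments ≡ []
      no-alphas = alphas-all-true (map⁺ (runs-all-true (reverse (positionsBefore σ y i)) (All.tabulate λ k∈ →
        let k<i = proj₂ (∈-filter⁻ (T? ∘ (λ k → toℕ k <ᵇ toℕ i)) {xs = allFin n} (reverse⁻ k∈)) in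
        <⇒<ᵇ≡true (all-smaller _ (<ᵇ⇒< _ _ k<i)))))

theorem3p5 : (n : ℕ) (σ : Permutation′ n) (y : Fin n → ℕ) → (∀ c → 1 ≤ y c) → (i : Fin n) →
    ((toℕ i ≡ 0 ⊎ Σ (Fin n) (λ j → suc (toℕ j) ≡ toℕ i × toℕ (car σ y i) < toℕ (car σ y j)))
      → length (Pref σ y i) ≡ 1)
    × ((1 ≤ toℕ i × (∀ (j : Fin n) → toℕ j < toℕ i → toℕ (car σ y j) < toℕ (car σ y i)))
      → length (Pref σ y i) ≡ 1 + before σ y i)
    × ((Σ (Fin n) (λ j → suc (toℕ j) ≡ toℕ i × toℕ (car σ y j) < toℕ (car σ y i))
        × Σ (Fin n) (λ j → toℕ j < toℕ i × toℕ (car σ y i) < toℕ (car σ y j)))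
      → ((∀ (j : Fin (length (alphaLengths σ y i))) → lookup (alphaLengths σ y i) j < len σ y i)
          → length (Pref σ y i) ≡ 1 + before σ y i)
        × (∀ (m : Fin (length (alphaLengths σ y i)))
          → len σ y i ≤ lookup (alphaLengths σ y i) m
          → (∀ (j : Fin (length (alphaLengths σ y i))) → toℕ j < toℕ m → lookup (alphaLengths σ y i) j < len σ y i)
          → length (Pref σ y i) ≡ len σ y i + sum (take (suc (toℕ m)) (betaLengths σ y i)) + sum (take (toℕ m) (alphaLengths σ y i))))
theorem3p5 n σ y y≥1 i =
    (λ { (inj₁ i≡0)                 → length-Pref-first i≡0
       ; (inj₂ (j , 1+j≡i , σi<σj)) → length-Pref-after-larger j 1+j≡i σi<σj })
  , (λ (i≥1 , all-smaller) → length-Pref-after-all-smaller i≥1 all-smaller)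
  , λ ((j , 1+j≡i , σj<σi) , _) →
      let alt = Alternating-after-smaller 1+j≡i σj<σi in length-Pref-all-short alt , length-Pref-first-long alt
  where open Street.At σ y y≥1 i
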